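{- Let $P_1(x)=p_0+p_1x+\dots+p_mx^m$ and $P_2(x)=p'_0+p'_1x+\dots+p'_nx^n$ be polynomials in $\mathcal E[x]$ such that, for $i\in\{1,2\}$, $\mathcal R_i=\mathcal E[x]/(P_i)$ with a set $\mathcal N_i\subset\mathcal E$ of representatives of $\mathcal R_i/(X)$ forms a digit system $(\mathcal R_i,X,\mathcal N_i)$. Let $\mathcal M=\{d+eP_1: d\in\mathcal N_1, e\in\mathcal N_2\}$ (viewed in $\mathcal E[x]/(P_1P_2)$). Then: (1) $(\mathcal E[x]/(P_1P_2),X,\mathcal M)$ is a digit system; (2) if $0\in\mathcal N_1$ and both $(\mathcal R_1,X,\mathcal N_1)$ and $(\mathcal R_2,X,\mathcal N_2)$ have the finite expansion property, then $(\mathcal E[x]/(P_1P_2),X,\mathcal M)$ has the finite expansion property; (3) if $0\in\mathcal N_1$, $(\mathcal R_1,X,\mathcal N_1)$ has the finite expansion property and $(\mathcal R_2,X,\mathcal N_2)$ has the periodic expansion property, then $(\mathcal E[x]/(P_1P_2),X,\mathcal M)$ has the periodic expansion property.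
   Context: $\mathcal E$ is a commutative ring with identity. A digit system is a triple $(\mathcal R,X,\mathcal N)$ where $\mathcal R=\mathcal E[x]/(P)$ for a polynomial $P=p_dx^d+\dots+p_0$ of degree $d\ge1$ with $p_d,p_0$ not zero divisors of $\mathcal E$ and $\mathcal E/(p_0)$ finite, $X$ is the image of $x$, and $\mathcal N\subset\mathcal R$ is a system of coset representatives of $\mathcal R/(X)$. For $A\in\mathcal R$, $D_{\mathcal N}(A)$ is the unique $e\in\mathcal N$ with $A\equiv e\pmod X$ and $T(A)=\frac{A-D_{\mathcal N}(A)}{X}$ (the unique $B$ with $XB=A-D_{\mathcal N}(A)$). Finite expansion property: for every $A\in\mathcal R$ there is $n\in\mathbb N$ with $T^n(A)=0$. Periodic expansion property: for every $A\in\mathcal R$ the sequence $(T^i(A))_{i\ge0}$ is eventually periodic. -}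

module Defs where

open import Level using (Level; _⊔_; Lift)
open import Algebra.Bundles using (CommutativeRing)
open import Data.Nat using (ℕ; zero; suc; _<_; _≤_)
open import Data.List using (List; []; _∷_; map)
open import Data.List.Relation.Unary.Any using (Any)
open import Data.Product using (Σ; _×_; _,_)
open import Relation.Unary using (Pred)

-- Polynomials over the carrier of a commutative ring, as coefficient
-- lists (lowest degree first); E[x]/(P) via the congruence mod P.
module _ {c ℓ : Level} (R : CommutativeRing c ℓ) where
  open CommutativeRing R

  Poly : Set c
  Poly = List Carrier

  coeff : Poly → ℕ → Carrier
  coeff []      _       = 0#
  coeff (a ∷ p) zero    = a
  coeff (a ∷ p) (suc i) = coeff p i

  _≈ₚ_ : Poly → Poly → Set ℓ
  p ≈ₚ q = ∀ i → coeff p i ≈ coeff q i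

  _+ₚ_ : Poly → Poly → Poly
  []      +ₚ q       = q
  (a ∷ p) +ₚ []      = a ∷ p
  (a ∷ p) +ₚ (b ∷ q) = (a + b) ∷ (p +ₚ q)

  scaleₚ : Carrier → Poly → Poly
  scaleₚ a = map (a *_)

  -ₚ_ : Poly → Poly
  -ₚ_ = map (-_)

  _-ₚ_ : Poly → Poly → Poly
  p -ₚ q = p +ₚ (-ₚ q)

  _*ₚ_ : Poly → Poly → Poly
  []      *ₚ q = []
  (a ∷ p) *ₚ q = scaleₚ a q +ₚ (0# ∷ (p *ₚ q))

  constₚ : Carrier → Poly
  constₚ a = a ∷ []

  Xₚ : Poly
  Xₚ = 0# ∷ 1# ∷ []

  NonZeroDivisor : Carrier → Set (c ⊔ ℓ)
  NonZeroDivisor a = ∀ b → a * b ≈ 0# → b ≈ 0#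

  -- E/(a) is finite: a finite list of elements meeting every coset of (a)
  FiniteQuotient : Carrier → Set (c ⊔ ℓ)
  FiniteQuotient a =
    Σ (List Carrier) λ L → ∀ b → Any (λ r → Σ Carrier λ t → b - r ≈ a * t) L

  AdmissiblePoly : Poly → Set (c ⊔ ℓ)
  AdmissiblePoly P = Σ ℕ λ d →
    (1 ≤ d) × (∀ i → d < i → coeff P i ≈ 0#)
    × NonZeroDivisor (coeff P d) × NonZeroDivisor (coeff P 0)
    × FiniteQuotient (coeff P 0)

  ModP : Poly → Poly → Poly → Set (c ⊔ ℓ)
  ModP P A B = Σ Poly λ Q → (A -ₚ B) ≈ₚ (Q *ₚ P)

  CongX : Poly → Poly → Poly → Set (c ⊔ ℓ)
  CongX P A B = Σ Poly λ C → ModP P (A -ₚ B) (Xₚ *ₚ C)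

  -- N (a subset of R, given by a predicate on representatives) is a
  -- system of coset representatives of R/(X)
  CosetReps : ∀ {n} → Poly → Pred Poly n → Set (c ⊔ ℓ ⊔ n)
  CosetReps P N =
    (∀ A → Σ Poly λ e → N e × CongX P A e)
    × (∀ e e′ → N e → N e′ → CongX P e e′ → ModP P e e′)

  DigitSystem : ∀ {n} → Poly → Pred Poly n → Set (c ⊔ ℓ ⊔ n)
  DigitSystem P N = AdmissiblePoly P × CosetReps P N

  -- B = T(A) in R: X·B = A - e for a digit e ∈ N (then e = D_N(A))
  TStep : ∀ {n} → Poly → Pred Poly n → Poly → Poly → Set (c ⊔ ℓ ⊔ n)
  TStep P N A B = Σ Poly λ e → N e × ModP P (Xₚ *ₚ B) (A -ₚ e)

  TIter : ∀ {n} → Poly → Pred Poly n → ℕ → Poly → Poly → Set (c ⊔ ℓ ⊔ n)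
  TIter {n} P N zero    A B = Lift n (ModP P A B)
  TIter P N (suc k) A B = Σ Poly λ A′ → TStep P N A A′ × TIter P N k A′ B

  FiniteExpansion : ∀ {n} → Poly → Pred Poly n → Set (c ⊔ ℓ ⊔ n)
  FiniteExpansion P N = ∀ A → Σ ℕ λ k → TIter P N k A []

  PeriodicExpansion : ∀ {n} → Poly → Pred Poly n → Set (c ⊔ ℓ ⊔ n)
  PeriodicExpansion P N = ∀ A → Σ ℕ λ k → Σ ℕ λ l → Σ Poly λ B →
    TIter P N k A B × TIter P N (suc l) B B

  ConstSet : ∀ {n} → Poly → Pred Carrier n → Pred Poly (c ⊔ ℓ ⊔ n)
  ConstSet P N A = Σ Carrier λ a → N a × ModP P A (constₚ a)

  MSet : ∀ {n} → Poly → Poly → Pred Carrier n → Pred Carrier n →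
         Pred Poly (c ⊔ ℓ ⊔ n)
  MSet P₁ P₂ N₁ N₂ A = Σ Carrier λ d → Σ Carrier λ e → N₁ d × N₂ e
    × ModP (P₁ *ₚ P₂) A (constₚ d +ₚ scaleₚ e P₁)

  HasZero : ∀ {n} → Pred Carrier n → Set (c ⊔ ℓ ⊔ n)
  HasZero N = Σ Carrier λ a → N a × a ≈ 0#

module Submission where

-- R/(X) ≅ E/(p₀) for R = E[x]/(P), p₀ = P(0), so constant digits
-- N form a digit system iff N is a complete residue system modulo p₀.
-- Residues d (mod a) and e (mod b) give the residues d + e·a (mod a·b)
-- ("mixed radix"), which yields part (1).  For (2) and (3): modulo P₁ the
-- digit d + e·P₁ is d, so a T-orbit for P₁P₂ projects to a T-orbit for P₁;
-- as T is a well-defined map, finite expansions for P₁ force every orbit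
-- to reach a multiple P₁·G.  If 0 ∈ N₁, multiplication by P₁ maps the
-- T-orbit of G for P₂ onto the T-orbit of P₁·G for P₁P₂, so the orbit
-- ends in 0 resp. becomes periodic when the one of G does.

open import Defs
open import Level using (Level; _⊔_; lift)
open import Algebra.Bundles using (CommutativeRing)
open import Data.Nat using (ℕ; zero; suc; s≤s; z≤n; _<_) renaming (_+_ to _+ℕ_)
open import Data.Nat.Properties using (m≤n⇒m<n∨m≡n; +-suc; m≤n+m; <⇒≤; ≤-trans; m≤m+n)
open import Data.List using (List; []; _∷_; length; map; concatMap)
open import Data.List.Relation.Unary.Any as Any using (Any)
open import Data.List.Relation.Unary.Any.Properties using (map⁺; concatMap⁺)
open import Data.Product using (Σ; _×_; _,_; proj₁; proj₂; uncurry)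
open import Data.Sum using (inj₁; inj₂)
open import Relation.Binary.Bundles using (Setoid)
import Relation.Binary.PropositionalEquality as ≡
open import Relation.Unary using (Pred)
import Relation.Binary.Reasoning.Setoid

-- In the polynomial ring its fields are exactly those of
-- Defs.ModP; it is a record (not a Σ-type) so that a, b and p can be
-- inferred, and it is declared outside the module below so that its
-- constructor can be shared by all rings.
record Congruent {c ℓ} (R : CommutativeRing c ℓ) (a b p : CommutativeRing.Carrier R) : Set (c ⊔ ℓ) where
  constructor _,_
  open CommutativeRing R
  field
    quotient : Carrier
    equality : a - b ≈ quotient * p

module Congruence {c ℓ} (R : CommutativeRing c ℓ) where
  open CommutativeRing R
  open import Algebra.Properties.Ring ring using (-0#≈0#; -‿distribˡ-*; x[y-z]≈xy-xz; [y-z]x≈yx-zx)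
  open import Algebra.Properties.AbelianGroup +-abelianGroup
    using (⁻¹-anti-homo‿-; ⁻¹-∙-comm; ⁻¹-involutive; x∙y⁻¹≈ε⇒x≈y; x≈y⇒x∙y⁻¹≈ε)
  open import Algebra.Properties.CommutativeSemigroup +-commutativeSemigroup
    using (interchange)
  open import Algebra.Properties.CommutativeSemigroup *-commutativeSemigroup
    using () renaming (x∙yz≈y∙xz to x*yz≈y*xz)
  open import Relation.Binary.Reasoning.Setoid setoid

  sub-sub : ∀ x y → x - (x - y) ≈ y
  sub-sub x y = begin
    x - (x - y)     ≈⟨ +-congˡ (⁻¹-anti-homo‿- x y) ⟩
    x + (y - x)     ≈⟨ +-congˡ (+-comm y (- x)) ⟩
    x + (- x + y)   ≈⟨ +-assoc x (- x) y ⟨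
    (x - x) + y     ≈⟨ +-congʳ (-‿inverseʳ x) ⟩
    0# + y          ≈⟨ +-identityˡ y ⟩
    y               ∎

  sub-+ : ∀ x y z → (x - y) + (y - z) ≈ x - z
  sub-+ x y z = begin
    (x - y) + (y - z)   ≈⟨ +-assoc x (- y) (y - z) ⟩
    x + (- y + (y - z)) ≈⟨ +-congˡ (+-assoc (- y) y (- z)) ⟨
    x + ((- y + y) - z) ≈⟨ +-congˡ (+-congʳ (-‿inverseˡ y)) ⟩
    x + (0# - z)        ≈⟨ +-congˡ (+-identityˡ (- z)) ⟩
    x - z               ∎

  +-sub : ∀ x y → (x + y) - x ≈ y
  +-sub x y = begin
    (x + y) - x  ≈⟨ +-congʳ (+-comm x y) ⟩
    (y + x) - x  ≈⟨ +-assoc y x (- x) ⟩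
    y + (x - x)  ≈⟨ +-congˡ (-‿inverseʳ x) ⟩
    y + 0#       ≈⟨ +-identityʳ y ⟩
    y            ∎

  sub-sub-sub : ∀ x y z → (x - y) - (x - z) ≈ z - y
  sub-sub-sub x y z = begin
    (x - y) - (x - z)  ≈⟨ +-congˡ (⁻¹-anti-homo‿- x z) ⟩
    (x - y) + (z - x)  ≈⟨ +-comm (x - y) (z - x) ⟩
    (z - x) + (x - y)  ≈⟨ sub-+ z x y ⟩
    z - y              ∎

  infix 4 _≡_mod_
  _≡_mod_ : Carrier → Carrier → Carrier → Set (c ⊔ ℓ)
  _≡_mod_ = Congruent R

  module _ {p : Carrier} where

    ≡-reflexive : ∀ {a b} → a ≈ b → a ≡ b mod p
    ≡-reflexive {a} {b} a≈b = 0# , trans (x≈y⇒x∙y⁻¹≈ε a≈b) (sym (zeroˡ p))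

    ≡-refl : ∀ {a} → a ≡ a mod p
    ≡-refl = ≡-reflexive refl

    ≡-sym : ∀ {a b} → a ≡ b mod p → b ≡ a mod p
    ≡-sym {a} {b} (q , h) = - q , (begin
      b - a      ≈⟨ ⁻¹-anti-homo‿- a b ⟨
      - (a - b)  ≈⟨ -‿cong h ⟩
      - (q * p)  ≈⟨ -‿distribˡ-* q p ⟩
      - q * p    ∎)

    ≡-trans : ∀ {a b d} → a ≡ b mod p → b ≡ d mod p → a ≡ d mod p
    ≡-trans {a} {b} {d} (q , h) (q′ , h′) = q + q′ , (begin
      a - d              ≈⟨ sub-+ a b d ⟨
      (a - b) + (b - d)  ≈⟨ +-cong h h′ ⟩
      q * p + q′ * p     ≈⟨ distribʳ p q q′ ⟨
      (q + q′) * p       ∎)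

    +-cong-mod : ∀ {a a′ b b′} → a ≡ a′ mod p → b ≡ b′ mod p →
                 a + b ≡ a′ + b′ mod p
    +-cong-mod {a} {a′} {b} {b′} (q , h) (q′ , h′) = q + q′ , (begin
      (a + b) - (a′ + b′)    ≈⟨ +-congˡ (⁻¹-∙-comm a′ b′) ⟨
      (a + b) + (- a′ - b′)  ≈⟨ interchange a b (- a′) (- b′) ⟩
      (a - a′) + (b - b′)    ≈⟨ +-cong h h′ ⟩
      q * p + q′ * p         ≈⟨ distribʳ p q q′ ⟨
      (q + q′) * p           ∎)

    -‿cong-mod : ∀ {a b} → a ≡ b mod p → - a ≡ - b mod p
    -‿cong-mod {a} {b} ab with ≡-sym ab
    ... | q , h = q , trans (trans (+-congˡ (⁻¹-involutive b)) (+-comm (- a) b)) h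

    -‿-cong-mod : ∀ {a a′ b b′} → a ≡ a′ mod p → b ≡ b′ mod p →
                  a - b ≡ a′ - b′ mod p
    -‿-cong-mod aa′ bb′ = +-cong-mod aa′ (-‿cong-mod bb′)

    +-multiple : ∀ a q → a + q * p ≡ a mod p
    +-multiple a q = q , +-sub a (q * p)

    modSetoid : Setoid c (c ⊔ ℓ)
    modSetoid = record
      { Carrier = Carrier
      ; _≈_ = _≡_mod p
      ; isEquivalence = record { refl = ≡-refl ; sym = ≡-sym ; trans = ≡-trans } }

  module ModReasoning (p : Carrier) = Relation.Binary.Reasoning.Setoid (modSetoid {p})

  ≡0⇒≡ : ∀ {p a b} → a - b ≡ 0# mod p → a ≡ b mod p
  ≡0⇒≡ {p} {a} {b} (q , h) = q , trans (sym (trans (+-congˡ -0#≈0#) (+-identityʳ (a - b)))) h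

  ≡-resp-mod : ∀ {p p′ a b} → p ≈ p′ → a ≡ b mod p → a ≡ b mod p′
  ≡-resp-mod p≈p′ (q , h) = q , trans h (*-congˡ p≈p′)

  mod-factor : ∀ {p q a b} → a ≡ b mod p * q → a ≡ b mod p
  mod-factor {p} {q} (s , h) = s * q , trans h (trans (*-congˡ (*-comm p q)) (sym (*-assoc s q p)))

  ≡-scale : ∀ x {p a b} → a ≡ b mod p → x * a ≡ x * b mod x * p
  ≡-scale x {p} {a} {b} (q , h) = q , (begin
    x * a - x * b  ≈⟨ x[y-z]≈xy-xz x a b ⟨
    x * (a - b)    ≈⟨ *-congˡ h ⟩
    x * (q * p)    ≈⟨ *-assoc x q p ⟨
    x * q * p      ≈⟨ *-congʳ (*-comm x q) ⟩
    q * x * p      ≈⟨ *-assoc q x p ⟩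
    q * (x * p)    ∎)

  cancel-mod : ∀ {a b x y} → NonZeroDivisor R a →
               x * a ≡ y * a mod a * b → x ≡ y mod b
  cancel-mod {a} {b} {x} {y} nzd (s , h) =
    s , x∙y⁻¹≈ε⇒x≈y (x - y) (s * b) (nzd ((x - y) - s * b) (begin
      a * ((x - y) - s * b)          ≈⟨ x[y-z]≈xy-xz a (x - y) (s * b) ⟩
      a * (x - y) - a * (s * b)      ≈⟨ -‿-cong (x[y-z]≈xy-xz a x y) (x*yz≈y*xz a s b) ⟩
      (a * x - a * y) - s * (a * b)  ≈⟨ -‿-cong (-‿-cong (*-comm a x) (*-comm a y)) refl ⟩
      (x * a - y * a) - s * (a * b)  ≈⟨ x≈y⇒x∙y⁻¹≈ε h ⟩
      0#                             ∎))
    where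
    -‿-cong : ∀ {u u′ v v′} → u ≈ u′ → v ≈ v′ → u - v ≈ u′ - v′
    -‿-cong u≈ v≈ = +-cong u≈ (-‿cong v≈)

  mixed-radix-step : ∀ {a b x d t e s} → x - d ≈ t * a → t - e ≈ s * b →
                     x - (d + e * a) ≈ s * (a * b)
  mixed-radix-step {a} {b} {x} {d} {t} {e} {s} x-d≈ta t-e≈sb = begin
    x - (d + e * a)    ≈⟨ +-congˡ (⁻¹-∙-comm d (e * a)) ⟨
    x + (- d - e * a)  ≈⟨ +-assoc x (- d) (- (e * a)) ⟨
    (x - d) - e * a    ≈⟨ +-congʳ x-d≈ta ⟩
    t * a - e * a      ≈⟨ [y-z]x≈yx-zx a t e ⟨
    (t - e) * a        ≈⟨ *-congʳ t-e≈sb ⟩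
    s * b * a          ≈⟨ *-assoc s b a ⟩
    s * (b * a)        ≈⟨ *-congˡ (*-comm b a) ⟩
    s * (a * b)        ∎


-- Complete residue systems in E and how they combine under products.
module Residues {c ℓ} (R : CommutativeRing c ℓ) where
  open CommutativeRing R
  open Congruence R

  CompleteResidues : ∀ {n} → Carrier → Pred Carrier n → Set (c ⊔ ℓ ⊔ n)
  CompleteResidues p N =
    (∀ a → Σ Carrier λ d → N d × a ≡ d mod p)
    × (∀ {d d′} → N d → N d′ → d ≡ d′ mod p → d ≈ d′)

  mixed-residues-exist : ∀ {n a b} {N₁ N₂ : Pred Carrier n} →
    CompleteResidues a N₁ → CompleteResidues b N₂ →
    ∀ x → Σ Carrier λ d → Σ Carrier λ e → N₁ d × N₂ e × x ≡ d + e * a mod a * b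
  mixed-residues-exist (exists₁ , _) (exists₂ , _) x
    with exists₁ x
  ... | d , N₁d , t , x≡d with exists₂ t
  ... | e , N₂e , s , t≡e = d , e , N₁d , N₂e , s , mixed-radix-step x≡d t≡e

  mixed-residues-unique : ∀ {n a b} {N₁ N₂ : Pred Carrier n} →
    NonZeroDivisor R a → CompleteResidues a N₁ → CompleteResidues b N₂ →
    ∀ {d e d′ e′} → N₁ d → N₂ e → N₁ d′ → N₂ e′ →
    d + e * a ≡ d′ + e′ * a mod a * b → d ≈ d′ × e ≈ e′
  mixed-residues-unique {a = a} {b} nzd (_ , unique₁) (_ , unique₂)
    {d} {e} {d′} {e′} N₁d N₂e N₁d′ N₂e′ h =
    d≈d′ , unique₂ N₂e N₂e′ (cancel-mod nzd ea≡e′a)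
    where
    d≈d′ : d ≈ d′
    d≈d′ = unique₁ N₁d N₁d′ (begin
      d              ≈⟨ +-multiple d e ⟨
      d + e * a      ≈⟨ mod-factor h ⟩
      d′ + e′ * a    ≈⟨ +-multiple d′ e′ ⟩
      d′             ∎)
      where open ModReasoning a
    ea≡e′a : e * a ≡ e′ * a mod a * b
    ea≡e′a = begin
      e * a                   ≈⟨ ≡-reflexive (+-sub d (e * a)) ⟨
      (d + e * a) - d         ≈⟨ -‿-cong-mod h (≡-reflexive d≈d′) ⟩
      (d′ + e′ * a) - d′      ≈⟨ ≡-reflexive (+-sub d′ (e′ * a)) ⟩
      e′ * a                  ∎
      where open ModReasoning (a * b)

  nonZeroDivisor-* : ∀ {u a b} → u ≈ a * b →
    NonZeroDivisor R a → NonZeroDivisor R b → NonZeroDivisor R u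
  nonZeroDivisor-* {u} {a} {b} u≈ab nzdᵃ nzdᵇ x ux≈0 =
    nzdᵇ x (nzdᵃ (b * x) (trans (sym (*-assoc a b x)) (trans (*-congʳ (sym u≈ab)) ux≈0)))

  -- E/(a·b) is finite when E/(a) and E/(b) are: the residues r₁ + r₂·a
  finiteQuotient-* : ∀ {u a b} → u ≈ a * b →
    FiniteQuotient R a → FiniteQuotient R b → FiniteQuotient R u
  finiteQuotient-* {u} {a} {b} u≈ab (L₁ , cover₁) (L₂ , cover₂) =
    concatMap digitsAbove L₁ , λ x → concatMap⁺ digitsAbove (Any.map (refine x) (cover₁ x))
    where
    digitsAbove : Carrier → List Carrier
    digitsAbove r₁ = map (λ r₂ → r₁ + r₂ * a) L₂
    -- x − r₁ = a·t and t − r₂ = b·s give x − (r₁ + r₂·a) = u·s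
    refine : ∀ x {r₁} → Σ Carrier (λ t → x - r₁ ≈ a * t) →
             Any (λ r → Σ Carrier λ s → x - r ≈ u * s) (digitsAbove r₁)
    refine x (t , x-r₁≈at) = map⁺ (Any.map (λ (s , t-r₂≈bs) → s ,
      trans (mixed-radix-step (trans x-r₁≈at (*-comm a t)) (trans t-r₂≈bs (*-comm b s)))
            (trans (*-comm s (a * b)) (*-congʳ (sym u≈ab))))
      (cover₂ t))

-- The ring E[x] of coefficient lists, with equality coefficientwise.
module PolynomialRing {c ℓ} (R : CommutativeRing c ℓ) where
  open CommutativeRing R
  open import Algebra.Properties.Ring ring using (-0#≈0#)
  open import Algebra.Properties.CommutativeSemigroup +-commutativeSemigroup
    using (interchange; x∙yz≈y∙xz)
  open import Relation.Binary.Reasoning.Setoid setoid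

  infixl 6 _⊕_
  infixl 7 _⊗_
  infix 4 _≋_

  _⊕_ _⊗_ : Poly R → Poly R → Poly R
  _⊕_ = _+ₚ_ R
  _⊗_ = _*ₚ_ R

  ⊝ : Poly R → Poly R
  ⊝ = -ₚ_ R

  infixl 6 _⊖_
  _⊖_ : Poly R → Poly R → Poly R
  _⊖_ = _-ₚ_ R

  _≋_ : Poly R → Poly R → Set ℓ
  _≋_ = _≈ₚ_ R

  cf : Poly R → ℕ → Carrier
  cf = coeff R

  sc : Carrier → Poly R → Poly R
  sc = scaleₚ R

  cst : Carrier → Poly R
  cst = constₚ R

  coeff-+ : ∀ p q i → cf (p ⊕ q) i ≈ cf p i + cf q i
  coeff-+ []      q       i       = sym (+-identityˡ _)
  coeff-+ (a ∷ p) []      i       = sym (+-identityʳ _)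
  coeff-+ (a ∷ p) (b ∷ q) zero    = refl
  coeff-+ (a ∷ p) (b ∷ q) (suc i) = coeff-+ p q i

  coeff-neg : ∀ p i → cf (⊝ p) i ≈ - cf p i
  coeff-neg []      i       = sym -0#≈0#
  coeff-neg (a ∷ p) zero    = refl
  coeff-neg (a ∷ p) (suc i) = coeff-neg p i

  coeff-scale : ∀ a p i → cf (sc a p) i ≈ a * cf p i
  coeff-scale a []      i       = sym (zeroʳ a)
  coeff-scale a (b ∷ p) zero    = refl
  coeff-scale a (b ∷ p) (suc i) = coeff-scale a p i

  coeff-∷*-zero : ∀ a p q → cf ((a ∷ p) ⊗ q) 0 ≈ a * cf q 0
  coeff-∷*-zero a p q = trans (coeff-+ (sc a q) (0# ∷ (p ⊗ q)) 0)
    (trans (+-identityʳ _) (coeff-scale a q 0))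

  coeff-∷*-suc : ∀ a p q i → cf ((a ∷ p) ⊗ q) (suc i) ≈ a * cf q (suc i) + cf (p ⊗ q) i
  coeff-∷*-suc a p q i = trans (coeff-+ (sc a q) (0# ∷ (p ⊗ q)) (suc i))
    (+-congʳ (coeff-scale a q (suc i)))

  ∷*-ext : ∀ a p q r → a * cf q 0 ≈ cf r 0 →
           (∀ i → a * cf q (suc i) + cf (p ⊗ q) i ≈ cf r (suc i)) → (a ∷ p) ⊗ q ≋ r
  ∷*-ext a p q r h₀ hₛ zero    = trans (coeff-∷*-zero a p q) h₀
  ∷*-ext a p q r h₀ hₛ (suc i) = trans (coeff-∷*-suc a p q i) (hₛ i)

  ∷-cong : ∀ {a b p q} → a ≈ b → p ≋ q → (a ∷ p) ≋ (b ∷ q)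
  ∷-cong a≈b p≋q zero    = a≈b
  ∷-cong a≈b p≋q (suc i) = p≋q i

  +-congₚ : ∀ {p p′ q q′} → p ≋ p′ → q ≋ q′ → p ⊕ q ≋ p′ ⊕ q′
  +-congₚ {p} {p′} {q} {q′} p≋p′ q≋q′ i =
    trans (coeff-+ p q i) (trans (+-cong (p≋p′ i) (q≋q′ i)) (sym (coeff-+ p′ q′ i)))

  -‿congₚ : ∀ {p q} → p ≋ q → ⊝ p ≋ ⊝ q
  -‿congₚ {p} {q} p≋q i = trans (coeff-neg p i) (trans (-‿cong (p≋q i)) (sym (coeff-neg q i)))

  scale-cong : ∀ {a a′ p p′} → a ≈ a′ → p ≋ p′ → sc a p ≋ sc a′ p′
  scale-cong {a} {a′} {p} {p′} a≈a′ p≋p′ i =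
    trans (coeff-scale a p i) (trans (*-cong a≈a′ (p≋p′ i)) (sym (coeff-scale a′ p′ i)))

  zero-* : ∀ p q → p ≋ [] → p ⊗ q ≋ []
  zero-* []      q p≋0 = λ _ → refl
  zero-* (a ∷ p) q p≋0 = ∷*-ext a p q []
    (trans (*-congʳ (p≋0 0)) (zeroˡ _))
    (λ i → trans (+-cong (trans (*-congʳ (p≋0 0)) (zeroˡ _)) (zero-* p q (λ j → p≋0 (suc j)) i))
                 (+-identityʳ _))

  *-congʳₚ : ∀ {p p′} q → p ≋ p′ → p ⊗ q ≋ p′ ⊗ q
  *-congʳₚ {[]}    {[]}     q p≋p′ = λ _ → refl
  *-congʳₚ {[]}    {a ∷ p′} q p≋p′ = λ i → sym (zero-* (a ∷ p′) q (λ j → sym (p≋p′ j)) i)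
  *-congʳₚ {a ∷ p} {[]}     q p≋p′ = zero-* (a ∷ p) q p≋p′
  *-congʳₚ {a ∷ p} {a′ ∷ p′} q p≋p′ = ∷*-ext a p q ((a′ ∷ p′) ⊗ q)
    (trans (*-congʳ (p≋p′ 0)) (sym (coeff-∷*-zero a′ p′ q)))
    (λ i → trans (+-cong (*-congʳ (p≋p′ 0)) (*-congʳₚ {p} {p′} q (λ j → p≋p′ (suc j)) i))
                 (sym (coeff-∷*-suc a′ p′ q i)))

  *-congˡₚ : ∀ p {q q′} → q ≋ q′ → p ⊗ q ≋ p ⊗ q′
  *-congˡₚ []      q≋q′ = λ _ → refl
  *-congˡₚ (a ∷ p) {q} {q′} q≋q′ = ∷*-ext a p q ((a ∷ p) ⊗ q′)
    (trans (*-congˡ (q≋q′ 0)) (sym (coeff-∷*-zero a p q′)))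
    (λ i → trans (+-cong (*-congˡ (q≋q′ (suc i))) (*-congˡₚ p {q} {q′} q≋q′ i))
                 (sym (coeff-∷*-suc a p q′ i)))

  *-zeroʳₚ : ∀ q → q ⊗ [] ≋ []
  *-zeroʳₚ []      = λ _ → refl
  *-zeroʳₚ (b ∷ q) = ∷*-ext b q [] [] (zeroʳ b)
    (λ i → trans (+-cong (zeroʳ b) (*-zeroʳₚ q i)) (+-identityʳ _))

  coeff-*∷-zero : ∀ q a p → cf (q ⊗ (a ∷ p)) 0 ≈ cf q 0 * a
  coeff-*∷-zero []      a p = sym (zeroˡ a)
  coeff-*∷-zero (b ∷ q) a p = coeff-∷*-zero b q (a ∷ p)

  coeff-*∷-suc : ∀ q a p i → cf (q ⊗ (a ∷ p)) (suc i) ≈ cf q (suc i) * a + cf (q ⊗ p) i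
  coeff-*∷-suc []      a p i = sym (trans (+-identityʳ _) (zeroˡ a))
  coeff-*∷-suc (b ∷ q) a p zero = begin
    cf ((b ∷ q) ⊗ (a ∷ p)) 1       ≈⟨ coeff-∷*-suc b q (a ∷ p) 0 ⟩
    b * cf p 0 + cf (q ⊗ (a ∷ p)) 0 ≈⟨ +-congˡ (coeff-*∷-zero q a p) ⟩
    b * cf p 0 + cf q 0 * a         ≈⟨ +-comm _ _ ⟩
    cf q 0 * a + b * cf p 0         ≈⟨ +-congˡ (coeff-∷*-zero b q p) ⟨
    cf q 0 * a + cf ((b ∷ q) ⊗ p) 0 ∎
  coeff-*∷-suc (b ∷ q) a p (suc i) = begin
    cf ((b ∷ q) ⊗ (a ∷ p)) (suc (suc i))                ≈⟨ coeff-∷*-suc b q (a ∷ p) (suc i) ⟩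
    b * cf p (suc i) + cf (q ⊗ (a ∷ p)) (suc i)         ≈⟨ +-congˡ (coeff-*∷-suc q a p i) ⟩
    b * cf p (suc i) + (cf q (suc i) * a + cf (q ⊗ p) i) ≈⟨ x∙yz≈y∙xz _ _ _ ⟩
    cf q (suc i) * a + (b * cf p (suc i) + cf (q ⊗ p) i) ≈⟨ +-congˡ (coeff-∷*-suc b q p i) ⟨
    cf q (suc i) * a + cf ((b ∷ q) ⊗ p) (suc i)          ∎

  *-commₚ : ∀ p q → p ⊗ q ≋ q ⊗ p
  *-commₚ []      q = λ i → sym (*-zeroʳₚ q i)
  *-commₚ (a ∷ p) q = ∷*-ext a p q (q ⊗ (a ∷ p))
    (trans (*-comm _ _) (sym (coeff-*∷-zero q a p)))
    (λ i → trans (+-cong (*-comm _ _) (*-commₚ p q i)) (sym (coeff-*∷-suc q a p i)))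

  *-distribˡₚ : ∀ p q r → p ⊗ (q ⊕ r) ≋ p ⊗ q ⊕ p ⊗ r
  *-distribˡₚ []      q r = λ _ → refl
  *-distribˡₚ (a ∷ p) q r = ∷*-ext a p (q ⊕ r) ((a ∷ p) ⊗ q ⊕ (a ∷ p) ⊗ r)
    (begin
      a * cf (q ⊕ r) 0                                   ≈⟨ *-congˡ (coeff-+ q r 0) ⟩
      a * (cf q 0 + cf r 0)                              ≈⟨ distribˡ a _ _ ⟩
      a * cf q 0 + a * cf r 0                            ≈⟨ +-cong (coeff-∷*-zero a p q) (coeff-∷*-zero a p r) ⟨
      cf ((a ∷ p) ⊗ q) 0 + cf ((a ∷ p) ⊗ r) 0            ≈⟨ coeff-+ ((a ∷ p) ⊗ q) ((a ∷ p) ⊗ r) 0 ⟨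
      cf ((a ∷ p) ⊗ q ⊕ (a ∷ p) ⊗ r) 0                   ∎)
    (λ i → begin
      a * cf (q ⊕ r) (suc i) + cf (p ⊗ (q ⊕ r)) i        ≈⟨ +-cong (*-congˡ (coeff-+ q r (suc i))) (*-distribˡₚ p q r i) ⟩
      a * (cf q (suc i) + cf r (suc i)) + cf (p ⊗ q ⊕ p ⊗ r) i
                                                         ≈⟨ +-cong (distribˡ a _ _) (coeff-+ (p ⊗ q) (p ⊗ r) i) ⟩
      (a * cf q (suc i) + a * cf r (suc i)) + (cf (p ⊗ q) i + cf (p ⊗ r) i)
                                                         ≈⟨ interchange _ _ _ _ ⟩
      (a * cf q (suc i) + cf (p ⊗ q) i) + (a * cf r (suc i) + cf (p ⊗ r) i)
                                                         ≈⟨ +-cong (coeff-∷*-suc a p q i) (coeff-∷*-suc a p r i) ⟨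
      cf ((a ∷ p) ⊗ q) (suc i) + cf ((a ∷ p) ⊗ r) (suc i) ≈⟨ coeff-+ ((a ∷ p) ⊗ q) ((a ∷ p) ⊗ r) (suc i) ⟨
      cf ((a ∷ p) ⊗ q ⊕ (a ∷ p) ⊗ r) (suc i)             ∎)

  *-distribʳₚ : ∀ r p q → (p ⊕ q) ⊗ r ≋ p ⊗ r ⊕ q ⊗ r
  *-distribʳₚ r p q i = trans (*-commₚ (p ⊕ q) r i)
    (trans (*-distribˡₚ r p q i)
           (+-congₚ {r ⊗ p} {p ⊗ r} {r ⊗ q} {q ⊗ r} (*-commₚ r p) (*-commₚ r q) i))

  const-* : ∀ a p → cst a ⊗ p ≋ sc a p
  const-* a p i = trans (coeff-+ (sc a p) (0# ∷ []) i) (trans (+-congˡ (zero-coeff i)) (+-identityʳ _))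
    where
    zero-coeff : ∀ i → cf (0# ∷ []) i ≈ 0#
    zero-coeff zero    = refl
    zero-coeff (suc i) = refl

  scale-* : ∀ a q r → sc a q ⊗ r ≋ sc a (q ⊗ r)
  scale-* a []      r = λ _ → refl
  scale-* a (b ∷ q) r = ∷*-ext (a * b) (sc a q) r (sc a ((b ∷ q) ⊗ r))
    (trans (*-assoc a b _)
      (sym (trans (coeff-scale a ((b ∷ q) ⊗ r) 0) (*-congˡ (coeff-∷*-zero b q r)))))
    (λ i → trans (+-cong (*-assoc a b _) (trans (scale-* a q r i) (coeff-scale a (q ⊗ r) i)))
      (trans (sym (distribˡ a _ _))
        (sym (trans (coeff-scale a ((b ∷ q) ⊗ r) (suc i)) (*-congˡ (coeff-∷*-suc b q r i))))))

  shift-* : ∀ s r → (0# ∷ s) ⊗ r ≋ (0# ∷ (s ⊗ r))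
  shift-* s r = ∷*-ext 0# s r (0# ∷ (s ⊗ r)) (zeroˡ _)
    (λ i → trans (+-congʳ (zeroˡ _)) (+-identityˡ _))

  *-assocₚ : ∀ p q r → (p ⊗ q) ⊗ r ≋ p ⊗ (q ⊗ r)
  *-assocₚ []      q r = λ _ → refl
  *-assocₚ (a ∷ p) q r i = trans (*-distribʳₚ r (sc a q) (0# ∷ (p ⊗ q)) i)
    (+-congₚ {sc a q ⊗ r} {sc a (q ⊗ r)} {(0# ∷ (p ⊗ q)) ⊗ r} {0# ∷ (p ⊗ (q ⊗ r))}
      (scale-* a q r)
      (λ j → trans (shift-* (p ⊗ q) r j) (∷-cong {0#} {0#} {(p ⊗ q) ⊗ r} refl (*-assocₚ p q r) j)) i)

  *-identityˡₚ : ∀ p → cst 1# ⊗ p ≋ p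
  *-identityˡₚ p i = trans (const-* 1# p i) (trans (coeff-scale 1# p i) (*-identityˡ _))

  +-assocₚ : ∀ p q r → (p ⊕ q) ⊕ r ≋ p ⊕ (q ⊕ r)
  +-assocₚ p q r i = begin
    cf ((p ⊕ q) ⊕ r) i          ≈⟨ coeff-+ (p ⊕ q) r i ⟩
    cf (p ⊕ q) i + cf r i       ≈⟨ +-congʳ (coeff-+ p q i) ⟩
    cf p i + cf q i + cf r i    ≈⟨ +-assoc _ _ _ ⟩
    cf p i + (cf q i + cf r i)  ≈⟨ +-congˡ (coeff-+ q r i) ⟨
    cf p i + cf (q ⊕ r) i       ≈⟨ coeff-+ p (q ⊕ r) i ⟨
    cf (p ⊕ (q ⊕ r)) i          ∎

  +-commₚ : ∀ p q → p ⊕ q ≋ q ⊕ p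
  +-commₚ p q i = trans (coeff-+ p q i) (trans (+-comm _ _) (sym (coeff-+ q p i)))

  +-identityʳₚ : ∀ p → p ⊕ [] ≋ p
  +-identityʳₚ p i = trans (coeff-+ p [] i) (+-identityʳ _)

  -‿inverseʳₚ : ∀ p → p ⊕ ⊝ p ≋ []
  -‿inverseʳₚ p i = trans (coeff-+ p (⊝ p) i) (trans (+-congˡ (coeff-neg p i)) (-‿inverseʳ _))

  PolyRing : CommutativeRing c ℓ
  PolyRing = record
    { Carrier = Poly R
    ; _≈_ = _≋_
    ; _+_ = _⊕_
    ; _*_ = _⊗_
    ; -_ = ⊝
    ; 0# = []
    ; 1# = cst 1#
    ; isCommutativeRing = record
      { isRing = record
        { +-isAbelianGroup = record
          { isGroup = record
            { isMonoid = record
              { isSemigroup = record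
                { isMagma = record
                  { isEquivalence = record
                    { refl = λ _ → refl
                    ; sym = λ p≋q i → sym (p≋q i)
                    ; trans = λ p≋q q≋r i → trans (p≋q i) (q≋r i) }
                  ; ∙-cong = λ {p} {p′} {q} {q′} → +-congₚ {p} {p′} {q} {q′} }
                ; assoc = +-assocₚ }
              ; identity = (λ _ _ → refl) , +-identityʳₚ }
            ; inverse = (λ p i → trans (+-commₚ (⊝ p) p i) (-‿inverseʳₚ p i)) , -‿inverseʳₚ
            ; ⁻¹-cong = λ {p} {q} → -‿congₚ {p} {q} }
          ; comm = +-commₚ }
        ; *-cong = λ {p} {p′} {q} {q′} p≋p′ q≋q′ i →
            trans (*-congʳₚ {p} {p′} q p≋p′ i) (*-congˡₚ p′ {q} {q′} q≋q′ i)
        ; *-assoc = *-assocₚ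
        ; *-identity = *-identityˡₚ , (λ p i → trans (*-commₚ p (cst 1#) i) (*-identityˡₚ p i))
        ; distrib = *-distribˡₚ , *-distribʳₚ }
      ; *-comm = *-commₚ } }

-- Digit systems (E[x]/(P), X, N) and the dynamics of T, phrased with the
-- congruences of E (qualified E.) and of E[x] (unqualified).
module DigitSystems {c ℓ} (R : CommutativeRing c ℓ) where
  open CommutativeRing R
  open PolynomialRing R
  open Residues R
  module E = Congruence R
  open Congruence PolyRing
  open import Algebra.Properties.AbelianGroup +-abelianGroup using (x∙y⁻¹≈ε⇒x≈y)
  open import Algebra.Properties.Ring (CommutativeRing.ring PolyRing)
    using () renaming (x[y-z]≈xy-xz to ⊗-distribˡ-⊖)
  open import Algebra.Properties.CommutativeSemigroup (CommutativeRing.*-commutativeSemigroup PolyRing)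
    using () renaming (x∙yz≈y∙xz to x⊗yz≈y⊗xz)
  module ≈-Reasoning = Relation.Binary.Reasoning.Setoid setoid

  Xp : Poly R
  Xp = Xₚ R

  fromModP : ∀ P A B → ModP R P A B → A ≡ B mod P
  fromModP P A B (q , h) = q , h

  toModP : ∀ {P A B} → A ≡ B mod P → ModP R P A B
  toModP (q , h) = q , h

  modP-refl : ∀ P A → ModP R P A A
  modP-refl P A = toModP (≡-refl {P} {A})

  -- The constant coefficient is a ring homomorphism E[x] → E, hence maps
  -- congruences modulo P to congruences modulo its constant term.
  coeff₀-* : ∀ p q → cf (p ⊗ q) 0 ≈ cf p 0 * cf q 0
  coeff₀-* []      q = sym (zeroˡ _)
  coeff₀-* (a ∷ p) q = coeff-∷*-zero a p q

  coeff-- : ∀ A B i → cf (A ⊖ B) i ≈ cf A i - cf B i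
  coeff-- A B i = trans (coeff-+ A (⊝ B) i) (+-congˡ (coeff-neg B i))

  coeff₀-mod : ∀ {P A B} → A ≡ B mod P → cf A 0 E.≡ cf B 0 mod cf P 0
  coeff₀-mod {P} {A} {B} (Q , h) =
    cf Q 0 , trans (sym (coeff-- A B 0)) (trans (h 0) (coeff₀-* Q P))

  coeff-X*-zero : ∀ C → cf (Xp ⊗ C) 0 ≈ 0#
  coeff-X*-zero C = trans (coeff-∷*-zero 0# (1# ∷ []) C) (zeroˡ _)

  coeff-X*-suc : ∀ C i → cf (Xp ⊗ C) (suc i) ≈ cf C i
  coeff-X*-suc C i = trans (coeff-∷*-suc 0# (1# ∷ []) C i)
    (trans (+-congʳ (zeroˡ _)) (trans (+-identityˡ _) (*-identityˡₚ C i)))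

  tail : Poly R → Poly R
  tail []      = []
  tail (a ∷ p) = p

  X-divides : ∀ F → cf F 0 ≈ 0# → F ≋ Xp ⊗ tail F
  X-divides F       F₀≈0 zero    = trans F₀≈0 (sym (coeff-X*-zero (tail F)))
  X-divides []      F₀≈0 (suc i) = sym (coeff-X*-suc [] i)
  X-divides (a ∷ F) F₀≈0 (suc i) = sym (coeff-X*-suc F i)

  -- A ≡ B in R/(X) (Defs.CongX) iff their constant terms agree modulo p₀:
  -- R/(X) ≅ E/(p₀).
  congX⇒coeff₀ : ∀ P A B → CongX R P A B → cf A 0 E.≡ cf B 0 mod cf P 0
  congX⇒coeff₀ P A B (C , A-B≡XC) = E.≡0⇒≡ (begin
    cf A 0 - cf B 0  ≈⟨ E.≡-reflexive (coeff-- A B 0) ⟨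
    cf (A ⊖ B) 0     ≈⟨ coeff₀-mod (fromModP P (A ⊖ B) (Xp ⊗ C) A-B≡XC) ⟩
    cf (Xp ⊗ C) 0    ≈⟨ E.≡-reflexive (coeff-X*-zero C) ⟩
    0#               ∎)
    where open E.ModReasoning (cf P 0)

  coeff₀⇒congX : ∀ P A B → cf A 0 E.≡ cf B 0 mod cf P 0 → CongX R P A B
  coeff₀⇒congX P A B (t , a₀-b₀≈tp₀) = tail F , toModP (begin
    A ⊖ B       ≈⟨ cst t , sub-sub (A ⊖ B) (cst t ⊗ P) ⟩
    F           ≈⟨ ≡-reflexive (X-divides F F₀≈0) ⟩
    Xp ⊗ tail F ∎)
    where
    open ModReasoning P
    F : Poly R
    F = (A ⊖ B) ⊖ cst t ⊗ P
    F₀≈0 : cf F 0 ≈ 0#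
    F₀≈0 = trans (coeff-- (A ⊖ B) (cst t ⊗ P) 0)
      (trans (+-cong (trans (coeff-- A B 0) a₀-b₀≈tp₀) (-‿cong (coeff₀-* (cst t) P)))
             (-‿inverseʳ _))

  X*-cancel : ∀ {P B B′} → NonZeroDivisor R (cf P 0) →
              Xp ⊗ B ≡ Xp ⊗ B′ mod P → B ≡ B′ mod P
  X*-cancel {P} {B} {B′} nzd₀ (G , XB-XB′≈GP) = tail G , λ i → begin
    cf (B ⊖ B′) i                  ≈⟨ coeff-X*-suc (B ⊖ B′) i ⟨
    cf (Xp ⊗ (B ⊖ B′)) (suc i)     ≈⟨ X*-distrib (suc i) ⟩
    cf (Xp ⊗ B ⊖ Xp ⊗ B′) (suc i)  ≈⟨ XB-XB′≈GP (suc i) ⟩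
    cf (G ⊗ P) (suc i)             ≈⟨ *-congʳₚ {G} {Xp ⊗ tail G} P (X-divides G G₀≈0) (suc i) ⟩
    cf ((Xp ⊗ tail G) ⊗ P) (suc i) ≈⟨ *-assocₚ Xp (tail G) P (suc i) ⟩
    cf (Xp ⊗ (tail G ⊗ P)) (suc i) ≈⟨ coeff-X*-suc (tail G ⊗ P) i ⟩
    cf (tail G ⊗ P) i              ∎
    where
    open ≈-Reasoning
    X*-distrib : Xp ⊗ (B ⊖ B′) ≋ Xp ⊗ B ⊖ Xp ⊗ B′
    X*-distrib = ⊗-distribˡ-⊖ Xp B B′
    G₀≈0 : cf G 0 ≈ 0#
    G₀≈0 = nzd₀ (cf G 0) (begin
      cf P 0 * cf G 0               ≈⟨ *-comm _ _ ⟩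
      cf G 0 * cf P 0               ≈⟨ coeff₀-* G P ⟨
      cf (G ⊗ P) 0                  ≈⟨ XB-XB′≈GP 0 ⟨
      cf (Xp ⊗ B ⊖ Xp ⊗ B′) 0       ≈⟨ X*-distrib 0 ⟨
      cf (Xp ⊗ (B ⊖ B′)) 0          ≈⟨ coeff-X*-zero (B ⊖ B′) ⟩
      0#                            ∎)

  DegreeAtMost : Poly R → ℕ → Set ℓ
  DegreeAtMost p k = ∀ i → k < i → cf p i ≈ 0#

  degree-length : ∀ p → DegreeAtMost p (length p)
  degree-length []      i       k<i       = refl
  degree-length (a ∷ p) (suc i) (s≤s k<i) = degree-length p i k<i

  coeff-top : ∀ Q k P d → DegreeAtMost Q k → DegreeAtMost P d →
              cf (Q ⊗ P) (k +ℕ d) ≈ cf Q k * cf P d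
  coeff-top []      k       P d       degQ degP = sym (zeroˡ _)
  coeff-top (a ∷ Q) zero    P zero    degQ degP = coeff-∷*-zero a Q P
  coeff-top (a ∷ Q) zero    P (suc d) degQ degP = trans (coeff-∷*-suc a Q P d)
    (trans (+-congˡ (zero-* Q P (λ j → degQ (suc j) (s≤s z≤n)) d)) (+-identityʳ _))
  coeff-top (a ∷ Q) (suc k) P d       degQ degP = trans (coeff-∷*-suc a Q P (k +ℕ d))
    (trans (+-cong (trans (*-congˡ (degP (suc (k +ℕ d)) (s≤s (m≤n+m d k)))) (zeroʳ a))
                   (coeff-top Q k P d (λ i k<i → degQ (suc i) (s≤s k<i)) degP))
           (+-identityˡ _))

  degree-* : ∀ Q k P d → DegreeAtMost Q k → DegreeAtMost P d → DegreeAtMost (Q ⊗ P) (k +ℕ d)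
  degree-* []      k       P d degQ degP i       _         = refl
  degree-* (a ∷ Q) zero    P d degQ degP (suc j) d<1+j     = trans (coeff-∷*-suc a Q P j)
    (trans (+-cong (trans (*-congˡ (degP (suc j) d<1+j)) (zeroʳ a))
                   (zero-* Q P (λ i → degQ (suc i) (s≤s z≤n)) j))
           (+-identityʳ _))
  degree-* (a ∷ Q) (suc k) P d degQ degP (suc j) (s≤s k+d<j) = trans (coeff-∷*-suc a Q P j)
    (trans (+-cong (trans (*-congˡ (degP (suc j) (s≤s (≤-trans (m≤n+m d k) (<⇒≤ k+d<j))))) (zeroʳ a))
                   (degree-* Q k P d (λ i k<i → degQ (suc i) (s≤s k<i)) degP j k+d<j))
           (+-identityʳ _))

  top-vanishes⇒zero : ∀ Q → (∀ j → DegreeAtMost Q j → cf Q j ≈ 0#) → Q ≋ []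
  top-vanishes⇒zero Q top≈0 = below (length Q) (degree-length Q)
    where
    below : ∀ k → DegreeAtMost Q k → Q ≋ []
    below zero    degQ zero    = top≈0 0 degQ
    below zero    degQ (suc i) = degQ (suc i) (s≤s z≤n)
    below (suc k) degQ         = below k degQ′
      where
      degQ′ : DegreeAtMost Q k
      degQ′ i k<i with m≤n⇒m<n∨m≡n k<i
      ... | inj₁ 1+k<i  = degQ i 1+k<i
      ... | inj₂ ≡.refl = top≈0 (suc k) degQ

  constants-rigid : ∀ {P} → AdmissiblePoly R P → ∀ {a b} → cst a ≡ cst b mod P → a ≈ b
  constants-rigid {P} (suc d , s≤s z≤n , degP , nzdᵈ , _ , _) {a} {b} (Q , a-b≈QP) =
    x∙y⁻¹≈ε⇒x≈y a b (trans (a-b≈QP 0) (zero-* Q P Q≋0 0))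
    where
    -- every top coefficient Qⱼ of Q satisfies p_d·Qⱼ = 0, as the constant
    -- a − b has no coefficient at x^(j+d+1)
    Q≋0 : Q ≋ []
    Q≋0 = top-vanishes⇒zero Q λ j degQ → nzdᵈ (cf Q j) (begin
      cf P (suc d) * cf Q j            ≈⟨ *-comm _ _ ⟩
      cf Q j * cf P (suc d)            ≈⟨ coeff-top Q j P (suc d) degQ degP ⟨
      cf (Q ⊗ P) (j +ℕ suc d)          ≈⟨ a-b≈QP (j +ℕ suc d) ⟨
      cf (cst a ⊖ cst b) (j +ℕ suc d)  ≡⟨ ≡.cong (cf (cst a ⊖ cst b)) (+-suc j d) ⟩
      cf (cst a ⊖ cst b) (suc (j +ℕ d)) ≡⟨⟩
      0#                               ∎)
      where open ≈-Reasoning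

  constant-nonZeroDivisor : ∀ P → AdmissiblePoly R P → NonZeroDivisor R (cf P 0)
  constant-nonZeroDivisor P (_ , _ , _ , _ , nzd₀ , _) = nzd₀

  -- The product of admissible polynomials is admissible: degrees add,
  -- leading and constant terms multiply.
  admissible-* : ∀ P₁ P₂ → AdmissiblePoly R P₁ → AdmissiblePoly R P₂ →
                 AdmissiblePoly R (P₁ ⊗ P₂)
  admissible-* P₁ P₂ (d₁ , 1≤d₁ , deg₁ , nzdᵈ₁ , nzd₀₁ , fin₁)
                     (d₂ , 1≤d₂ , deg₂ , nzdᵈ₂ , nzd₀₂ , fin₂) =
    d₁ +ℕ d₂ , ≤-trans 1≤d₁ (m≤m+n d₁ d₂) , degree-* P₁ d₁ P₂ d₂ deg₁ deg₂ ,
    nonZeroDivisor-* (coeff-top P₁ d₁ P₂ d₂ deg₁ deg₂) nzdᵈ₁ nzdᵈ₂ ,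
    nonZeroDivisor-* (coeff₀-* P₁ P₂) nzd₀₁ nzd₀₂ ,
    finiteQuotient-* (coeff₀-* P₁ P₂) fin₁ fin₂

  -- A digit system with constant digits N ⊆ E makes N a complete residue
  -- system modulo the constant term p₀ (as R/(X) ≅ E/(p₀)).
  constant-digits⇒residues : ∀ {n P} {N : Pred Carrier n} →
    DigitSystem R P (ConstSet R P N) → CompleteResidues (cf P 0) N
  constant-digits⇒residues {P = P} {N} (adm , exists , unique) = residue-exists , residue-unique
    where
    residue-exists : ∀ a → Σ Carrier λ d → N d × a E.≡ d mod cf P 0
    residue-exists a with exists (cst a)
    ... | e , (d , Nd , e≡d) , a≡e =
      d , Nd , E.≡-trans (congX⇒coeff₀ P (cst a) e a≡e) (coeff₀-mod (fromModP P e (cst d) e≡d))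

    residue-unique : ∀ {d d′} → N d → N d′ → d E.≡ d′ mod cf P 0 → d ≈ d′
    residue-unique {d} {d′} Nd Nd′ d≡d′ = constants-rigid adm (fromModP P (cst d) (cst d′)
      (unique (cst d) (cst d′) (d , Nd , modP-refl P (cst d)) (d′ , Nd′ , modP-refl P (cst d′))
              (coeff₀⇒congX P (cst d) (cst d′) d≡d′)))

  mixedDigit : Poly R → Carrier → Carrier → Poly R
  mixedDigit P₁ d e = cst d ⊕ sc e P₁

  coeff₀-mixedDigit : ∀ P₁ d e → cf (mixedDigit P₁ d e) 0 ≈ d + e * cf P₁ 0
  coeff₀-mixedDigit P₁ d e = trans (coeff-+ (cst d) (sc e P₁) 0) (+-congˡ (coeff-scale e P₁ 0))

  mixedDigit-cong : ∀ P₁ {d d′ e e′} → d ≈ d′ → e ≈ e′ →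
                    mixedDigit P₁ d e ≋ mixedDigit P₁ d′ e′
  mixedDigit-cong P₁ {d} {d′} {e} {e′} d≈d′ e≈e′ =
    +-congₚ {cst d} {cst d′} {sc e P₁} {sc e′ P₁} (∷-cong {d} {d′} {[]} {[]} d≈d′ (λ _ → refl))
                                                  (scale-cong {e} {e′} {P₁} {P₁} e≈e′ (λ _ → refl))

  mixedDigit-zero : ∀ P₁ {d} e → d ≈ 0# → mixedDigit P₁ d e ≋ sc e P₁
  mixedDigit-zero P₁ {d} e d≈0 i =
    trans (coeff-+ (cst d) (sc e P₁) i) (trans (+-congʳ (const-zero i)) (+-identityˡ _))
    where
    const-zero : ∀ i → cf (cst d) i ≈ 0#
    const-zero zero    = d≈0
    const-zero (suc i) = refl

  mixed-cosetReps : ∀ {n} P₁ P₂ {N₁ N₂ : Pred Carrier n} → NonZeroDivisor R (cf P₁ 0) →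
    CompleteResidues (cf P₁ 0) N₁ → CompleteResidues (cf P₂ 0) N₂ →
    CosetReps R (P₁ ⊗ P₂) (MSet R P₁ P₂ N₁ N₂)
  mixed-cosetReps {n} P₁ P₂ {N₁} {N₂} nzd res₁ res₂ = digit-exists , digit-unique
    where
    Q : Poly R
    Q = P₁ ⊗ P₂
    M : Pred (Poly R) (c ⊔ ℓ ⊔ n)
    M = MSet R P₁ P₂ N₁ N₂

    digit-exists : ∀ A → Σ (Poly R) λ m → M m × CongX R Q A m
    digit-exists A with mixed-residues-exist res₁ res₂ (cf A 0)
    ... | d , e , N₁d , N₂e , A₀≡ =
      mixedDigit P₁ d e , (d , e , N₁d , N₂e , modP-refl Q (mixedDigit P₁ d e)) ,
      coeff₀⇒congX Q A (mixedDigit P₁ d e) (E.≡-resp-mod (sym (coeff₀-* P₁ P₂))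
        (E.≡-trans A₀≡ (E.≡-reflexive (sym (coeff₀-mixedDigit P₁ d e)))))

    -- congruent digits have congruent constant terms, hence equal d and e
    same-digit : ∀ {m m′ d e d′ e′} →
                 m ≡ mixedDigit P₁ d e mod Q → m′ ≡ mixedDigit P₁ d′ e′ mod Q →
                 N₁ d → N₂ e → N₁ d′ → N₂ e′ → CongX R Q m m′ →
                 mixedDigit P₁ d e ≋ mixedDigit P₁ d′ e′
    same-digit {m} {m′} {d} {e} {d′} {e′} m≡ m′≡ N₁d N₂e N₁d′ N₂e′ m≡m′ =
      uncurry (mixedDigit-cong P₁) (mixed-residues-unique nzd res₁ res₂ N₁d N₂e N₁d′ N₂e′
        (E.≡-resp-mod (coeff₀-* P₁ P₂) (begin
          d + e * cf P₁ 0                 ≈⟨ E.≡-reflexive (coeff₀-mixedDigit P₁ d e) ⟨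
          cf (mixedDigit P₁ d e) 0        ≈⟨ coeff₀-mod m≡ ⟨
          cf m 0                          ≈⟨ congX⇒coeff₀ Q m m′ m≡m′ ⟩
          cf m′ 0                         ≈⟨ coeff₀-mod m′≡ ⟩
          cf (mixedDigit P₁ d′ e′) 0      ≈⟨ E.≡-reflexive (coeff₀-mixedDigit P₁ d′ e′) ⟩
          d′ + e′ * cf P₁ 0               ∎)))
      where open E.ModReasoning (cf Q 0)

    digit-unique : ∀ m m′ → M m → M m′ → CongX R Q m m′ → ModP R Q m m′
    digit-unique m m′ (d , e , N₁d , N₂e , m≡) (d′ , e′ , N₁d′ , N₂e′ , m′≡) m≡m′ = toModP (begin
      m                    ≈⟨ m≡ᴾ ⟩
      mixedDigit P₁ d e    ≈⟨ ≡-reflexive (same-digit m≡ᴾ m′≡ᴾ N₁d N₂e N₁d′ N₂e′ m≡m′) ⟩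
      mixedDigit P₁ d′ e′  ≈⟨ m′≡ᴾ ⟨
      m′                   ∎)
      where
      open ModReasoning Q
      m≡ᴾ : m ≡ mixedDigit P₁ d e mod Q
      m≡ᴾ = fromModP Q m (mixedDigit P₁ d e) m≡
      m′≡ᴾ : m′ ≡ mixedDigit P₁ d′ e′ mod Q
      m′≡ᴾ = fromModP Q m′ (mixedDigit P₁ d′ e′) m′≡

  -- Orbits of T.  Throughout, TIter k A B says T^k(A) = B.
  module _ {m} {P : Poly R} {N : Pred (Poly R) m} where

    iter-start : ∀ k {A A′ B} → A′ ≡ A mod P → TIter R P N k A B → TIter R P N k A′ B
    iter-start zero    {A} {A′} {B} A′≡A (lift A≡B) =
      lift (toModP (≡-trans A′≡A (fromModP P A B A≡B)))
    iter-start (suc k) {A} {A′} A′≡A (A₁ , (e , Ne , XA₁≡A-e) , rest) =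
      A₁ , (e , Ne , toModP (begin
        Xp ⊗ A₁  ≈⟨ fromModP P (Xp ⊗ A₁) (A ⊖ e) XA₁≡A-e ⟩
        A ⊖ e    ≈⟨ -‿-cong-mod {a = A} {A′} {e} (≡-sym A′≡A) ≡-refl ⟩
        A′ ⊖ e   ∎)) , rest
      where open ModReasoning P

    iter-end : ∀ k {A B B′} → B ≡ B′ mod P → TIter R P N k A B → TIter R P N k A B′
    iter-end zero    {A} {B} B≡B′ (lift A≡B) = lift (toModP (≡-trans (fromModP P A B A≡B) B≡B′))
    iter-end (suc k) B≡B′ (A₁ , step , rest) = A₁ , step , iter-end k B≡B′ rest

    iter-++ : ∀ k l {A B C} → TIter R P N k A B → TIter R P N l B C → TIter R P N (k +ℕ l) A C
    iter-++ zero    l {A} {B} (lift A≡B) rest = iter-start l (fromModP P A B A≡B) rest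
    iter-++ (suc k) l (A₁ , step , rest) rest′ = A₁ , step , iter-++ k l rest rest′

    orbit-exists : (∀ A → Σ (Poly R) λ e → N e × CongX R P A e) →
                   ∀ k A → Σ (Poly R) λ B → TIter R P N k A B
    orbit-exists digit zero    A = A , lift (modP-refl P A)
    orbit-exists digit (suc k) A with digit A
    ... | e , Ne , C , A-e≡XC with orbit-exists digit k C
    ... | B , rest = B , C , (e , Ne , toModP (≡-sym (fromModP P (A ⊖ e) (Xp ⊗ C) A-e≡XC))) , rest

    step-digit : ∀ {A B e} → Xp ⊗ B ≡ A ⊖ e mod P → e ≡ A ⊖ Xp ⊗ B mod P
    step-digit {A} {B} {e} XB≡A-e = begin
      e             ≈⟨ ≡-reflexive (sub-sub A e) ⟨
      A ⊖ (A ⊖ e)   ≈⟨ -‿-cong-mod {a = A} {A} {A ⊖ e} {Xp ⊗ B} ≡-refl (≡-sym XB≡A-e) ⟩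
      A ⊖ Xp ⊗ B    ∎
      where open ModReasoning P

    -- In a digit system T is a well-defined map on R: the digit of A
    -- is unique modulo P, and X can be cancelled.
    module _ (ds : DigitSystem R P N) where

      step-det : ∀ {A A′ B B′} → A ≡ A′ mod P →
                 TStep R P N A B → TStep R P N A′ B′ → B ≡ B′ mod P
      step-det {A} {A′} {B} {B′} A≡A′ (e , Ne , XB≡A-e) (e′ , Ne′ , XB′≡A′-e′) =
        X*-cancel (constant-nonZeroDivisor P (proj₁ ds)) (begin
          Xp ⊗ B    ≈⟨ XB≡A-eᴾ ⟩
          A ⊖ e     ≈⟨ -‿-cong-mod {a = A} {A′} {e} {e′} A≡A′ e≡e′ ⟩
          A′ ⊖ e′   ≈⟨ XB′≡A′-e′ᴾ ⟨
          Xp ⊗ B′   ∎)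
        where
        open ModReasoning P
        XB≡A-eᴾ : Xp ⊗ B ≡ A ⊖ e mod P
        XB≡A-eᴾ = fromModP P (Xp ⊗ B) (A ⊖ e) XB≡A-e
        XB′≡A′-e′ᴾ : Xp ⊗ B′ ≡ A′ ⊖ e′ mod P
        XB′≡A′-e′ᴾ = fromModP P (Xp ⊗ B′) (A′ ⊖ e′) XB′≡A′-e′
        -- the two digits differ by a multiple of X, hence agree
        e-e′≡X : e ⊖ e′ ≡ Xp ⊗ (B′ ⊖ B) mod P
        e-e′≡X = begin
          e ⊖ e′                        ≈⟨ -‿-cong-mod {a = e} {A ⊖ Xp ⊗ B} {e′} {A ⊖ Xp ⊗ B′}
                                             (step-digit XB≡A-eᴾ)
                                             (≡-trans (step-digit XB′≡A′-e′ᴾ)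
                                                      (-‿-cong-mod {a = A′} {A} {Xp ⊗ B′} (≡-sym A≡A′) ≡-refl)) ⟩
          (A ⊖ Xp ⊗ B) ⊖ (A ⊖ Xp ⊗ B′)  ≈⟨ ≡-reflexive (sub-sub-sub A (Xp ⊗ B) (Xp ⊗ B′)) ⟩
          Xp ⊗ B′ ⊖ Xp ⊗ B              ≈⟨ ≡-reflexive (⊗-distribˡ-⊖ Xp B′ B) ⟨
          Xp ⊗ (B′ ⊖ B)                 ∎
        e≡e′ : e ≡ e′ mod P
        e≡e′ = fromModP P e e′ (proj₂ (proj₂ ds) e e′ Ne Ne′ (B′ ⊖ B , toModP e-e′≡X))

      iter-det : ∀ k {A A′ B B′} → A ≡ A′ mod P →
                 TIter R P N k A B → TIter R P N k A′ B′ → B ≡ B′ mod P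
      iter-det zero    {A} {A′} {B} {B′} A≡A′ (lift A≡B) (lift A′≡B′) =
        ≡-trans (≡-sym (fromModP P A B A≡B)) (≡-trans A≡A′ (fromModP P A′ B′ A′≡B′))
      iter-det (suc k) A≡A′ (A₁ , step , rest) (A₁′ , step′ , rest′) =
        iter-det k (step-det A≡A′ step step′) rest rest′

  iter-transfer : ∀ {m m′ P Q} {N : Pred (Poly R) m} {N′ : Pred (Poly R) m′} →
    (∀ {A B} → A ≡ B mod Q → A ≡ B mod P) → (∀ {e} → N e → N′ e) →
    ∀ k {A B} → TIter R Q N k A B → TIter R P N′ k A B
  iter-transfer {Q = Q} Q⇒P N⊆N′ zero {A} {B} (lift A≡B) = lift (toModP (Q⇒P (fromModP Q A B A≡B)))
  iter-transfer {Q = Q} Q⇒P N⊆N′ (suc k) {A} (A₁ , (e , Ne , XA₁≡A-e) , rest) =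
    A₁ , (e , N⊆N′ Ne , toModP (Q⇒P (fromModP Q (Xp ⊗ A₁) (A ⊖ e) XA₁≡A-e))) ,
    iter-transfer Q⇒P N⊆N′ k rest

  iter-scale : ∀ {m m′ P} {N : Pred (Poly R) m} {N′ : Pred (Poly R) m′} C →
    (∀ {e} → N e → N′ (C ⊗ e)) →
    ∀ k {A B} → TIter R P N k A B → TIter R (C ⊗ P) N′ k (C ⊗ A) (C ⊗ B)
  iter-scale {P = P} C N→N′ zero {A} {B} (lift A≡B) = lift (toModP (≡-scale C (fromModP P A B A≡B)))
  iter-scale {P = P} C N→N′ (suc k) {A} (A₁ , (e , Ne , XA₁≡A-e) , rest) =
    C ⊗ A₁ , (C ⊗ e , N→N′ Ne , toModP (begin
      Xp ⊗ (C ⊗ A₁)  ≈⟨ ≡-reflexive (x⊗yz≈y⊗xz Xp C A₁) ⟩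
      C ⊗ (Xp ⊗ A₁)  ≈⟨ ≡-scale C (fromModP P (Xp ⊗ A₁) (A ⊖ e) XA₁≡A-e) ⟩
      C ⊗ (A ⊖ e)    ≈⟨ ≡-reflexive (⊗-distribˡ-⊖ C A e) ⟩
      C ⊗ A ⊖ C ⊗ e  ∎)) , iter-scale C N→N′ k rest
    where open ModReasoning (C ⊗ P)

module ProductSystem {c ℓ n} (R : CommutativeRing c ℓ) (P₁ P₂ : Poly R)
  (N₁ N₂ : Pred (CommutativeRing.Carrier R) n)
  (ds₁ : DigitSystem R P₁ (ConstSet R P₁ N₁)) (ds₂ : DigitSystem R P₂ (ConstSet R P₂ N₂)) where
  open CommutativeRing R
  open PolynomialRing R
  open Congruence PolyRing
  open DigitSystems R

  Q : Poly R
  Q = P₁ ⊗ P₂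

  M N₁ᶜ N₂ᶜ : Pred (Poly R) (c ⊔ ℓ ⊔ n)
  M = MSet R P₁ P₂ N₁ N₂
  N₁ᶜ = ConstSet R P₁ N₁
  N₂ᶜ = ConstSet R P₂ N₂

  product-digitSystem : DigitSystem R Q M
  product-digitSystem = admissible-* P₁ P₂ (proj₁ ds₁) (proj₁ ds₂) ,
    mixed-cosetReps P₁ P₂ (constant-nonZeroDivisor P₁ (proj₁ ds₁))
      (constant-digits⇒residues ds₁) (constant-digits⇒residues ds₂)

  -- Modulo P₁ the digit d + e·P₁ is just d: the T-orbits of (Q, M) are
  -- T-orbits of (P₁, N₁).
  M⊆N₁ : ∀ {m} → M m → N₁ᶜ m
  M⊆N₁ {m} (d , e , N₁d , _ , m≡) = d , N₁d , toModP (begin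
    m                   ≈⟨ mod-factor (fromModP Q m (mixedDigit P₁ d e) m≡) ⟩
    cst d ⊕ sc e P₁     ≈⟨ +-cong-mod {a = cst d} {cst d} {sc e P₁} {cst e ⊗ P₁}
                             ≡-refl (≡-reflexive (λ i → sym (const-* e P₁ i))) ⟩
    cst d ⊕ cst e ⊗ P₁  ≈⟨ +-multiple (cst d) (cst e) ⟩
    cst d               ∎)
    where open ModReasoning P₁

  -- If 0 ∈ N₁, then P₁ times a digit e of (P₂, N₂) is the digit 0 + e·P₁
  -- of M: multiplying by P₁ embeds the system of P₂ into that of Q.
  P₁N₂⊆M : HasZero R N₁ → ∀ {m} → N₂ᶜ m → M (P₁ ⊗ m)
  P₁N₂⊆M (z , N₁z , z≈0) {m} (e , N₂e , m≡e) = z , e , N₁z , N₂e , toModP (begin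
    P₁ ⊗ m              ≈⟨ ≡-scale P₁ (fromModP P₂ m (cst e) m≡e) ⟩
    P₁ ⊗ cst e          ≈⟨ ≡-reflexive (λ i → trans (*-commₚ P₁ (cst e) i) (const-* e P₁ i)) ⟩
    sc e P₁             ≈⟨ ≡-reflexive (mixedDigit-zero P₁ e z≈0) ⟨
    mixedDigit P₁ z e   ∎)
    where open ModReasoning Q

  -- With finite expansions for P₁, every orbit of (Q, M) reaches a
  -- multiple of P₁: if T₁ᵏ(A) = 0, the Q-orbit projects onto the P₁-orbit,
  -- so T^k(A) ≡ 0 modulo P₁.
  reach-multiple : FiniteExpansion R P₁ N₁ᶜ →
                   ∀ A → Σ ℕ λ k → Σ (Poly R) λ G → TIter R Q M k A (P₁ ⊗ G)
  reach-multiple fe₁ A =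
    let k , T₁ᵏA≡0 = fe₁ A
        B , TᵏA≡B = orbit-exists (proj₁ (proj₂ product-digitSystem)) k A
        T₁ᵏA≡B : TIter R P₁ N₁ᶜ k A B
        T₁ᵏA≡B = iter-transfer mod-factor (λ {m} → M⊆N₁ {m}) k TᵏA≡B
        G , B-0≋GP₁ = ≡-sym (iter-det ds₁ k ≡-refl T₁ᵏA≡0 T₁ᵏA≡B)
        B≋P₁G : B ≋ P₁ ⊗ G
        B≋P₁G i = trans (sym (+-identityʳₚ B i)) (trans (B-0≋GP₁ i) (*-commₚ G P₁ i))
    in k , G , iter-end k (≡-reflexive B≋P₁G) TᵏA≡B

  -- Part (2): the orbit of A reaches P₁·G, and then follows P₁ times the
  -- orbit of G, which ends in 0.
  finite : HasZero R N₁ → FiniteExpansion R P₁ N₁ᶜ → FiniteExpansion R P₂ N₂ᶜ →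
           FiniteExpansion R Q M
  finite 0∈N₁ fe₁ fe₂ A =
    let k , G , A→P₁G = reach-multiple fe₁ A
        l , G→0 = fe₂ G
        P₁G→0 : TIter R Q M l (P₁ ⊗ G) []
        P₁G→0 = iter-end l (≡-reflexive (*-zeroʳₚ P₁))
                  (iter-scale P₁ (λ {m} → P₁N₂⊆M 0∈N₁ {m}) l G→0)
    in k +ℕ l , iter-++ k l A→P₁G P₁G→0

  -- Part (3): likewise, P₁ times the eventually periodic orbit of G.
  periodic : HasZero R N₁ → FiniteExpansion R P₁ N₁ᶜ → PeriodicExpansion R P₂ N₂ᶜ →
             PeriodicExpansion R Q M
  periodic 0∈N₁ fe₁ pe₂ A =
    let k , G , A→P₁G = reach-multiple fe₁ A
        l , p , B , G→B , B→B = pe₂ G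
    in k +ℕ l , p , P₁ ⊗ B , iter-++ k l A→P₁G (P₁· l G→B) , P₁· (suc p) B→B
    where
    P₁· : ∀ k {A B} → TIter R P₂ N₂ᶜ k A B → TIter R Q M k (P₁ ⊗ A) (P₁ ⊗ B)
    P₁· = iter-scale P₁ (λ {m} → P₁N₂⊆M 0∈N₁ {m})

theorem4p1 : ∀ {c ℓ n : Level} (R : CommutativeRing c ℓ)
    (P₁ P₂ : Poly R) (N₁ N₂ : Pred (CommutativeRing.Carrier R) n) →
    DigitSystem R P₁ (ConstSet R P₁ N₁) →
    DigitSystem R P₂ (ConstSet R P₂ N₂) →
    DigitSystem R (_*ₚ_ R P₁ P₂) (MSet R P₁ P₂ N₁ N₂)
    × (HasZero R N₁ → FiniteExpansion R P₁ (ConstSet R P₁ N₁) →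
       FiniteExpansion R P₂ (ConstSet R P₂ N₂) →
       FiniteExpansion R (_*ₚ_ R P₁ P₂) (MSet R P₁ P₂ N₁ N₂))
    × (HasZero R N₁ → FiniteExpansion R P₁ (ConstSet R P₁ N₁) →
       PeriodicExpansion R P₂ (ConstSet R P₂ N₂) →
       PeriodicExpansion R (_*ₚ_ R P₁ P₂) (MSet R P₁ P₂ N₁ N₂))
theorem4p1 R P₁ P₂ N₁ N₂ ds₁ ds₂ = product-digitSystem , finite , periodic
  where open ProductSystem R P₁ P₂ N₁ N₂ ds₁ ds₂
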